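{- The properties $\mathrm{INC}$ and $\neg\mathrm{INC}$ of abstract rewrite systems are not generalised first-order properties.
   Context: An ARS is a pair $(A,\to)$, $A$ non-empty, ${\to}\subseteq A\times A$. It is increasing (INC) if there is a map $f:A\to\mathbb{N}$ with $f(a)<f(b)$ whenever $a\to b$. $\neg\mathrm{INC}$ is the property of not being increasing. A property $P$ is a generalised first-order property if there is a set $\Phi$ of sentences of first-order logic with equality and a binary predicate symbol $\to$ (interpreted as the one-step relation) such that for every ARS $\mathcal{A}$, $\mathcal{A}$ has $P$ iff $\mathcal{A}\models\Phi$. -}

module Defs where

open import Data.Nat using (ℕ; _<_)
open import Data.Fin using (Fin; zero; suc)
open import Data.Empty using (⊥)
open import Data.Unit using (⊤)
open import Data.Product using (Σ; _×_; ∃)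
open import Data.Sum using (_⊎_)
open import Relation.Nullary using (¬_)
open import Relation.Binary.PropositionalEquality using (_≡_)

record ARS : Set₁ where
  field
    Carrier : Set
    _⟶_     : Carrier → Carrier → Set
    inhabitant : Carrier
open ARS public

INC : ARS → Set
INC 𝒜 = Σ (Carrier 𝒜 → ℕ) λ f → ∀ a b → _⟶_ 𝒜 a b → f a < f b

-- First-order formulas with equality over the signature {→} (one binary
-- predicate symbol), with de Bruijn variables: Formula n has n free variables.
data Formula : ℕ → Set where
  _≐_  : ∀ {n} → Fin n → Fin n → Formula n
  _⇾_  : ∀ {n} → Fin n → Fin n → Formula n
  ⊤̇    : ∀ {n} → Formula n
  ⊥̇    : ∀ {n} → Formula n
  ¬̇_   : ∀ {n} → Formula n → Formula n
  _∧̇_  : ∀ {n} → Formula n → Formula n → Formula n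
  _∨̇_  : ∀ {n} → Formula n → Formula n → Formula n
  _⇒̇_  : ∀ {n} → Formula n → Formula n → Formula n
  ∀̇_   : ∀ {n} → Formula (Data.Nat.suc n) → Formula n
  ∃̇_   : ∀ {n} → Formula (Data.Nat.suc n) → Formula n

Sentence : Set
Sentence = Formula 0

_∷ₑ_ : ∀ {A : Set} {n} → A → (Fin n → A) → Fin (Data.Nat.suc n) → A
(a ∷ₑ ρ) zero    = a
(a ∷ₑ ρ) (suc i) = ρ i

Sat : (𝒜 : ARS) → ∀ {n} → (Fin n → Carrier 𝒜) → Formula n → Set
Sat 𝒜 ρ (i ≐ j)   = ρ i ≡ ρ j
Sat 𝒜 ρ (i ⇾ j)   = _⟶_ 𝒜 (ρ i) (ρ j)
Sat 𝒜 ρ ⊤̇         = ⊤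
Sat 𝒜 ρ ⊥̇         = ⊥
Sat 𝒜 ρ (¬̇ φ)     = ¬ Sat 𝒜 ρ φ
Sat 𝒜 ρ (φ ∧̇ ψ)   = Sat 𝒜 ρ φ × Sat 𝒜 ρ ψ
Sat 𝒜 ρ (φ ∨̇ ψ)   = Sat 𝒜 ρ φ ⊎ Sat 𝒜 ρ ψ
Sat 𝒜 ρ (φ ⇒̇ ψ)   = Sat 𝒜 ρ φ → Sat 𝒜 ρ ψ
Sat 𝒜 ρ (∀̇ φ)     = ∀ a → Sat 𝒜 (a ∷ₑ ρ) φ
Sat 𝒜 ρ (∃̇ φ)     = Σ (Carrier 𝒜) λ a → Sat 𝒜 (a ∷ₑ ρ) φ

_⊨_ : ARS → Sentence → Set
𝒜 ⊨ φ = Sat 𝒜 (λ ()) φ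

_⊨ₛ_ : ARS → (Sentence → Set) → Set
𝒜 ⊨ₛ Φ = ∀ φ → Φ φ → 𝒜 ⊨ φ

GenFO : (ARS → Set) → Set₁
GenFO P = Σ (Sentence → Set) λ Φ → ∀ 𝒜 → (P 𝒜 → 𝒜 ⊨ₛ Φ) × (𝒜 ⊨ₛ Φ → P 𝒜)

-- (ℕ, successor) is increasing, while ℕ ⊎ ℤ with the successor relation is not,
-- since ℤ contains an infinite descending chain; yet the two structures satisfy
-- the same first-order sentences, and a generalised first-order property cannot
-- distinguish them. Elementary equivalence is an Ehrenfeucht–Fraïssé argument:
-- call two finite tuples (each extended by the end 0 of the ray) k-similar if
-- they have the same displacements below 2^(k+1). A new point on one side is
-- either close to an old point, and is then answered by the point at the same
-- displacement from its partner (which cannot fall off the end of the ray), or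
-- far from all old points, and is then answered by a point far from all old
-- points on the other side; the result is (k-1)-similar. So formulas of
-- quantifier depth k are preserved between k-similar tuples.

module Submission where

open import Defs
open import Data.Product using (_×_; ∃; _,_; proj₁; proj₂)
open import Relation.Nullary using (¬_; Dec; yes; no)
open import Data.Nat using (ℕ; zero; suc; _≤_; _<_; _⊔_; z≤n; s≤s)
  renaming (_+_ to _+ℕ_)
import Data.Nat.Properties as ℕ
open import Data.Integer
  using (ℤ; +_; -[1+_]; 0ℤ; 1ℤ; ∣_∣; _+_; _-_; -_; +≤+; +<+)
  renaming (_≤_ to _≤ℤ_; _<_ to _<ℤ_)
import Data.Integer.Properties as ℤ
open import Data.Integer.Tactic.RingSolver using (solve-∀)
open import Data.Fin using (Fin; zero; suc)
open import Data.Fin.Properties using (any?)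
open import Data.List using (tabulate)
open import Data.List.Extrema.Nat using (max; xs≤max)
open import Data.List.Relation.Unary.All.Properties using (tabulate⁻)
open import Data.Maybe using (Maybe; just; nothing)
open import Data.Maybe.Properties using (just-injective)
open import Data.Sum using (_⊎_; inj₁; inj₂; map₁)
open import Data.Empty using (⊥-elim)
open import Data.Unit using (tt)
open import Function using (_∘_)
open import Relation.Binary.PropositionalEquality

GenFO-preserved : ∀ {P 𝒜 ℬ} → GenFO P → (∀ φ → 𝒜 ⊨ φ → ℬ ⊨ φ) → P 𝒜 → P ℬ
GenFO-preserved {𝒜 = 𝒜} {ℬ} (_ , defines) transfer p𝒜 =
  proj₂ (defines ℬ) (λ φ φ∈Φ → transfer φ (proj₁ (defines 𝒜) p𝒜 φ φ∈Φ))

¬INC-descending : ∀ 𝒜 (c : ℕ → Carrier 𝒜) → (∀ m → _⟶_ 𝒜 (c (suc m)) (c m)) → ¬ INC 𝒜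
¬INC-descending 𝒜 c step (f , mono) = ℕ.n≮n (f (c 0)) (ℕ.m+n≤o⇒m≤o (suc (f (c 0))) (descent _))
  where
  descent : ∀ m → m +ℕ f (c m) ≤ f (c 0)
  descent zero = ℕ.≤-refl
  descent (suc m) = ℕ.≤-trans (ℕ.+-monoʳ-< m (mono _ _ (step m))) (descent m)

-- Abstracts both models: disp x y is y − x for two points of the same component
-- and nothing across components; origin is the end of the ray.
record DisplacementSpace : Set₁ where
  field
    Point          : Set
    origin         : Point
    disp           : Point → Point → Maybe ℤ
    disp-refl      : ∀ x → disp x x ≡ just 0ℤ
    disp-zero      : ∀ {x y} → disp x y ≡ just 0ℤ → x ≡ y
    disp-trans     : ∀ {x y z d e} → disp x y ≡ just d → disp y z ≡ just e → disp x z ≡ just (d + e)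
    disp-sym       : ∀ {x y d} → disp x y ≡ just d → disp y x ≡ just (- d)
    origin-minimal : ∀ {x d} → disp origin x ≡ just d → 0ℤ ≤ℤ d
    translate      : ∀ x e → (∃ λ y → disp x y ≡ just e)
                             ⊎ (∃ λ m → disp origin x ≡ just m × m + e <ℤ 0ℤ)
    far-point      : ∀ {n} (P : Fin n → Point) t →
                     ∃ λ y → ∀ i {d} → disp (P i) y ≡ just d → t ≤ ∣ d ∣
open DisplacementSpace

successorARS : DisplacementSpace → ARS
successorARS S = record
  { Carrier = Point S ; _⟶_ = λ x y → disp S x y ≡ just 1ℤ ; inhabitant = origin S }

FarFrom : ∀ S → ℕ → ∀ {m} → (Fin m → Point S) → Point S → Set
FarFrom S t P a = ∀ i {d} → disp S (P i) a ≡ just d → t ≤ ∣ d ∣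

Preserves : ∀ S₁ S₂ → ℕ → ∀ {m} → (Fin m → Point S₁) → (Fin m → Point S₂) → Set
Preserves S₁ S₂ t P Q =
  ∀ i j {d} → disp S₁ (P i) (P j) ≡ just d → ∣ d ∣ < t → disp S₂ (Q i) (Q j) ≡ just d

record Agree S₁ S₂ (t : ℕ) {m} (P : Fin m → Point S₁) (Q : Fin m → Point S₂) : Set where
  field
    forth : Preserves S₁ S₂ t P Q
    back  : Preserves S₂ S₁ t Q P

Similar : ∀ S₁ S₂ → ℕ → ∀ {n} → (Fin n → Point S₁) → (Fin n → Point S₂) → Set
Similar S₁ S₂ t ρ σ = Agree S₁ S₂ t (origin S₁ ∷ₑ ρ) (origin S₂ ∷ₑ σ)

data Response S₁ S₂ (t : ℕ) {m} (P : Fin m → Point S₁) (Q : Fin m → Point S₂)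
              (a : Point S₁) (b : Point S₂) : Set where
  near : ∀ p {d} → disp S₁ (P p) a ≡ just d → disp S₂ (Q p) b ≡ just d → ∣ d ∣ < t →
         Response S₁ S₂ t P Q a b
  far  : FarFrom S₁ t P a → FarFrom S₂ t Q b → Response S₁ S₂ t P Q a b

self-disp : ∀ S₁ S₂ {x y d} → disp S₁ x x ≡ just d → disp S₂ y y ≡ just d
self-disp S₁ S₂ {x} {y} x→x =
  subst (λ d → disp S₂ y y ≡ just d) (just-injective (trans (sym (disp-refl S₁ x)) x→x)) (disp-refl S₂ y)

open Agree

Agree-sym : ∀ {S₁ S₂ t m} {P : Fin m → Point S₁} {Q} → Agree S₁ S₂ t P Q → Agree S₂ S₁ t Q P
Agree-sym A = record { forth = back A ; back = forth A }

Response-sym : ∀ {S₁ S₂ t m} {P : Fin m → Point S₁} {Q a b} →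
               Response S₁ S₂ t P Q a b → Response S₂ S₁ t Q P b a
Response-sym (near p P→a Q→b small) = near p Q→b P→a small
Response-sym (far P-far Q-far) = far Q-far P-far

response-disp : ∀ S₁ S₂ {t m} {P : Fin m → Point S₁} {Q a b} → Preserves S₁ S₂ (t +ℕ t) P Q →
                Response S₁ S₂ t P Q a b →
                ∀ j {d} → disp S₁ a (P j) ≡ just d → ∣ d ∣ < t → disp S₂ b (Q j) ≡ just d
response-disp S₁ S₂ {Q = Q} {b = b} H (near p {e} Pp→a Qp→b e-small) j {d} a→Pj d-small =
  subst (λ x → disp S₂ b (Q j) ≡ just x) (-e+[e+d]≡d e d)
    (disp-trans S₂ (disp-sym S₂ Qp→b)
      (H p j (disp-trans S₁ Pp→a a→Pj)
        (ℕ.≤-<-trans (ℤ.∣i+j∣≤∣i∣+∣j∣ e d) (ℕ.+-mono-< e-small d-small))))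
  where
  -e+[e+d]≡d : ∀ e d → - e + (e + d) ≡ d
  -e+[e+d]≡d = solve-∀
response-disp S₁ S₂ {t} H (far P-far _) j {d} a→Pj d-small =
  ⊥-elim (ℕ.<⇒≱ d-small (subst (t ≤_) (ℤ.∣-i∣≡∣i∣ d) (P-far j (disp-sym S₁ a→Pj))))

Preserves-extend : ∀ S₁ S₂ {t m} {P : Fin m → Point S₁} {Q a b} → Preserves S₁ S₂ (t +ℕ t) P Q →
                   Response S₁ S₂ t P Q a b → Preserves S₁ S₂ t (a ∷ₑ P) (b ∷ₑ Q)
Preserves-extend S₁ S₂ H R zero zero a→a _ = self-disp S₁ S₂ a→a
Preserves-extend S₁ S₂ H R zero (suc j) a→Pj small = response-disp S₁ S₂ H R j a→Pj small
Preserves-extend S₁ S₂ {t} {Q = Q} {b = b} H R (suc i) zero {d} Pi→a small =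
  subst (λ e → disp S₂ (Q i) b ≡ just e) (ℤ.neg-involutive d)
    (disp-sym S₂ (response-disp S₁ S₂ H R i (disp-sym S₁ Pi→a)
                   (subst (_< t) (sym (ℤ.∣-i∣≡∣i∣ d)) small)))
Preserves-extend S₁ S₂ {t} H R (suc i) (suc j) Pi→Pj small =
  H i j Pi→Pj (ℕ.<-≤-trans small (ℕ.m≤m+n t t))

swap₀₁ : ∀ {n} → Fin (suc (suc n)) → Fin (suc (suc n))
swap₀₁ zero = suc zero
swap₀₁ (suc zero) = zero
swap₀₁ (suc (suc i)) = suc (suc i)

∷ₑ-swap : ∀ {A : Set} {n} (x y : A) (ρ : Fin n → A) i → (y ∷ₑ (x ∷ₑ ρ)) i ≡ (x ∷ₑ (y ∷ₑ ρ)) (swap₀₁ i)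
∷ₑ-swap x y ρ zero = refl
∷ₑ-swap x y ρ (suc zero) = refl
∷ₑ-swap x y ρ (suc (suc i)) = refl

Preserves-reindex : ∀ S₁ S₂ {t k m} {P : Fin m → Point S₁} {Q} {P′ : Fin k → Point S₁} {Q′}
                    (g : Fin k → Fin m) → (∀ i → P′ i ≡ P (g i)) → (∀ i → Q′ i ≡ Q (g i)) →
                    Preserves S₁ S₂ t P Q → Preserves S₁ S₂ t P′ Q′
Preserves-reindex S₁ S₂ g P′≗ Q′≗ H i j P′i→P′j small
  rewrite P′≗ i | P′≗ j | Q′≗ i | Q′≗ j = H (g i) (g j) P′i→P′j small

Similar-extend : ∀ S₁ S₂ {t n} {ρ : Fin n → Point S₁} {σ a b} → Similar S₁ S₂ (t +ℕ t) ρ σ →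
                 Response S₁ S₂ t (origin S₁ ∷ₑ ρ) (origin S₂ ∷ₑ σ) a b →
                 Similar S₁ S₂ t (a ∷ₑ ρ) (b ∷ₑ σ)
Similar-extend S₁ S₂ {ρ = ρ} {σ} {a} {b} A R = record
  { forth = Preserves-reindex S₁ S₂ swap₀₁ (∷ₑ-swap a (origin S₁) ρ) (∷ₑ-swap b (origin S₂) σ)
              (Preserves-extend S₁ S₂ (forth A) R)
  ; back  = Preserves-reindex S₂ S₁ swap₀₁ (∷ₑ-swap b (origin S₂) σ) (∷ₑ-swap a (origin S₁) ρ)
              (Preserves-extend S₂ S₁ (back A) (Response-sym R))
  }

∣m∣<∣d∣ : ∀ {m d} → 0ℤ ≤ℤ m → m + d <ℤ 0ℤ → ∣ m ∣ < ∣ d ∣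
∣m∣<∣d∣ {+ k} {+ n} _ (+<+ ())
∣m∣<∣d∣ {+ k} {d = -[1+ n ]} _ m+d<0 with k ℕ.<? suc n
... | yes k<1+n = k<1+n
... | no k≮1+n with +<+ () ← subst (_<ℤ 0ℤ) (ℤ.⊖-≥ (ℕ.≮⇒≥ k≮1+n)) m+d<0

Near : ∀ S → ℕ → Point S → Point S → Set
Near S t x y = ∃ λ d → disp S x y ≡ just d × ∣ d ∣ < t

near? : ∀ S t x y → Dec (Near S t x y)
near? S t x y with disp S x y
... | nothing = no λ { (_ , () , _) }
... | just d with ∣ d ∣ ℕ.<? t
...   | yes small = yes (d , refl , small)
...   | no ¬small = no λ { (_ , refl , small) → ¬small small }

respond : ∀ S₁ S₂ {n} t {ρ : Fin n → Point S₁} {σ} → Similar S₁ S₂ (t +ℕ t) ρ σ →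
          ∀ a → ∃ λ b → Response S₁ S₂ t (origin S₁ ∷ₑ ρ) (origin S₂ ∷ₑ σ) a b
respond S₁ S₂ t {ρ} {σ} A a with any? (λ p → near? S₁ t ((origin S₁ ∷ₑ ρ) p) a)
... | yes (p , d , Pp→a , small) with translate S₂ ((origin S₂ ∷ₑ σ) p) d
...   | inj₁ (b , Qp→b) = b , near p Pp→a Qp→b small
...   | inj₂ (m , o→Qp , m+d<0) =
  -- the partner would lie below the origin of S₂, so a lies below the origin of S₁
  ⊥-elim (ℤ.<⇒≱ m+d<0 (origin-minimal S₁ (disp-trans S₁ o→Pp Pp→a)))
  where
  o→Pp : disp S₁ (origin S₁) ((origin S₁ ∷ₑ ρ) p) ≡ just m
  o→Pp = back A zero p o→Qp
    (ℕ.<-trans (∣m∣<∣d∣ (origin-minimal S₂ o→Qp) m+d<0) (ℕ.<-≤-trans small (ℕ.m≤m+n t t)))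
respond S₁ S₂ t {ρ} {σ} A a | no ¬near with far-point S₂ (origin S₂ ∷ₑ σ) t
... | b , Q-far = b , far (λ i Pi→a → ℕ.≮⇒≥ (λ small → ¬near (i , _ , Pi→a , small))) Q-far

quantifierDepth : ∀ {n} → Formula n → ℕ
quantifierDepth (i ≐ j) = 0
quantifierDepth (i ⇾ j) = 0
quantifierDepth ⊤̇ = 0
quantifierDepth ⊥̇ = 0
quantifierDepth (¬̇ φ) = quantifierDepth φ
quantifierDepth (φ ∧̇ ψ) = quantifierDepth φ ⊔ quantifierDepth ψ
quantifierDepth (φ ∨̇ ψ) = quantifierDepth φ ⊔ quantifierDepth ψ
quantifierDepth (φ ⇒̇ ψ) = quantifierDepth φ ⊔ quantifierDepth ψ
quantifierDepth (∀̇ φ) = suc (quantifierDepth φ)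
quantifierDepth (∃̇ φ) = suc (quantifierDepth φ)

radius : ℕ → ℕ
radius zero = 2
radius (suc k) = radius k +ℕ radius k

1<radius : ∀ k → 1 < radius k
1<radius zero = ℕ.≤-refl
1<radius (suc k) = ℕ.<-≤-trans (1<radius k) (ℕ.m≤m+n (radius k) (radius k))

Sat-transfer : ∀ S₁ S₂ {n} (φ : Formula n) k → quantifierDepth φ ≤ k →
               {ρ : Fin n → Point S₁} {σ : Fin n → Point S₂} → Similar S₁ S₂ (radius k) ρ σ →
               Sat (successorARS S₁) ρ φ → Sat (successorARS S₂) σ φ
Sat-transfer S₁ S₂ (i ≐ j) k _ {ρ} A ρi≡ρj =
  disp-zero S₂ (forth A (suc i) (suc j)
    (subst (λ x → disp S₁ (ρ i) x ≡ just 0ℤ) ρi≡ρj (disp-refl S₁ (ρ i))) (ℕ.<⇒≤ (1<radius k)))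
Sat-transfer S₁ S₂ (i ⇾ j) k _ A step = forth A (suc i) (suc j) step (1<radius k)
Sat-transfer S₁ S₂ ⊤̇ k _ A _ = tt
Sat-transfer S₁ S₂ ⊥̇ k _ A ()
Sat-transfer S₁ S₂ (¬̇ φ) k d≤k A ¬sφ sφ = ¬sφ (Sat-transfer S₂ S₁ φ k d≤k (Agree-sym A) sφ)
Sat-transfer S₁ S₂ (φ ∧̇ ψ) k d≤k A (sφ , sψ) =
  Sat-transfer S₁ S₂ φ k (ℕ.m⊔n≤o⇒m≤o _ _ d≤k) A sφ , Sat-transfer S₁ S₂ ψ k (ℕ.m⊔n≤o⇒n≤o _ _ d≤k) A sψ
Sat-transfer S₁ S₂ (φ ∨̇ ψ) k d≤k A (inj₁ sφ) = inj₁ (Sat-transfer S₁ S₂ φ k (ℕ.m⊔n≤o⇒m≤o _ _ d≤k) A sφ)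
Sat-transfer S₁ S₂ (φ ∨̇ ψ) k d≤k A (inj₂ sψ) = inj₂ (Sat-transfer S₁ S₂ ψ k (ℕ.m⊔n≤o⇒n≤o _ _ d≤k) A sψ)
Sat-transfer S₁ S₂ (φ ⇒̇ ψ) k d≤k A sφ⇒sψ sφ =
  Sat-transfer S₁ S₂ ψ k (ℕ.m⊔n≤o⇒n≤o _ _ d≤k) A
    (sφ⇒sψ (Sat-transfer S₂ S₁ φ k (ℕ.m⊔n≤o⇒m≤o _ _ d≤k) (Agree-sym A) sφ))
Sat-transfer S₁ S₂ (∀̇ φ) (suc k) (s≤s d≤k) A sφ b =
  let a , R = respond S₂ S₁ (radius k) (Agree-sym A) b
  in Sat-transfer S₁ S₂ φ k d≤k (Agree-sym (Similar-extend S₂ S₁ (Agree-sym A) R)) (sφ a)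
Sat-transfer S₁ S₂ (∃̇ φ) (suc k) (s≤s d≤k) A (a , sφ) =
  let b , R = respond S₁ S₂ (radius k) A a
  in b , Sat-transfer S₁ S₂ φ k d≤k (Similar-extend S₁ S₂ A R) sφ

Preserves-origins : ∀ S₁ S₂ {t} {ρ : Fin 0 → Point S₁} {σ} →
                    Preserves S₁ S₂ t (origin S₁ ∷ₑ ρ) (origin S₂ ∷ₑ σ)
Preserves-origins S₁ S₂ zero zero o→o _ = self-disp S₁ S₂ o→o

⊨-transfer : ∀ S₁ S₂ φ → successorARS S₁ ⊨ φ → successorARS S₂ ⊨ φ
⊨-transfer S₁ S₂ φ = Sat-transfer S₁ S₂ φ (quantifierDepth φ) ℕ.≤-refl
  record { forth = Preserves-origins S₁ S₂ ; back = Preserves-origins S₂ S₁ }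

offset : ℤ → ℤ → Maybe ℤ
offset i j = just (j - i)

offset-refl : ∀ i → offset i i ≡ just 0ℤ
offset-refl i = cong just (ℤ.+-inverseʳ i)

offset-zero : ∀ i j → offset i j ≡ just 0ℤ → i ≡ j
offset-zero i j eq = sym (ℤ.i-j≡0⇒i≡j j i (just-injective eq))

offset-trans : ∀ i j k {d e} → offset i j ≡ just d → offset j k ≡ just e → offset i k ≡ just (d + e)
offset-trans i j k refl refl =
  cong just (sym (trans (ℤ.+-comm (j - i) (k - j)) (ℤ.+-minus-telescope k j i)))

offset-sym : ∀ i j {d} → offset i j ≡ just d → offset j i ≡ just (- d)
offset-sym i j refl = cong just (i-j≡-[j-i] i j)
  where
  i-j≡-[j-i] : ∀ i j → i - j ≡ - (j - i)
  i-j≡-[j-i] = solve-∀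

offset-+ : ∀ i e → offset i (i + e) ≡ just e
offset-+ i e = cong just ([i+e]-i≡e i e)
  where
  [i+e]-i≡e : ∀ i e → (i + e) - i ≡ e
  [i+e]-i≡e = solve-∀

ℕ-translate : ∀ x e → (∃ λ y → offset (+ x) (+ y) ≡ just e)
                      ⊎ (∃ λ m → offset 0ℤ (+ x) ≡ just m × m + e <ℤ 0ℤ)
ℕ-translate x e with 0ℤ ℤ.≤? + x + e
... | yes 0≤x+e = inj₁ (∣ + x + e ∣ , subst (λ y → offset (+ x) y ≡ just e)
                                             (sym (ℤ.0≤i⇒+∣i∣≡i 0≤x+e)) (offset-+ (+ x) e))
... | no 0≰x+e = inj₂ (_ , refl , subst (λ m → m + e <ℤ 0ℤ) (sym (ℤ.+-identityʳ (+ x))) (ℤ.≰⇒> 0≰x+e))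

upperBound : ∀ {n} → (Fin n → ℕ) → ℕ
upperBound P = max 0 (tabulate P)

≤-upperBound : ∀ {n} (P : Fin n → ℕ) i → P i ≤ upperBound P
≤-upperBound P = tabulate⁻ (xs≤max 0 (tabulate P))

offset-beyond : ∀ {s x} t → x ≤ s → ∀ {d} → offset (+ x) (+ (s +ℕ t)) ≡ just d → t ≤ ∣ d ∣
offset-beyond {s} {x} t x≤s refl
  rewrite ℤ.[+m]-[+n]≡m⊖n (s +ℕ t) x | ℤ.⊖-≥ (ℕ.≤-trans x≤s (ℕ.m≤m+n s t)) =
  ℕ.m+n≤o⇒m≤o∸n t (subst (_≤ s +ℕ t) (ℕ.+-comm x t) (ℕ.+-monoˡ-≤ t x≤s))

ℕ-ray : DisplacementSpace
ℕ-ray = record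
  { Point          = ℕ
  ; origin         = 0
  ; disp           = λ x y → offset (+ x) (+ y)
  ; disp-refl      = λ x → offset-refl (+ x)
  ; disp-zero      = λ {x} {y} eq → ℤ.+-injective (offset-zero (+ x) (+ y) eq)
  ; disp-trans     = λ {x} {y} {z} → offset-trans (+ x) (+ y) (+ z)
  ; disp-sym       = λ {x} {y} → offset-sym (+ x) (+ y)
  ; origin-minimal = λ { refl → +≤+ z≤n }
  ; translate      = ℕ-translate
  ; far-point      = λ P t → upperBound P +ℕ t , λ i → offset-beyond t (≤-upperBound P i)
  }

ℕ-ray-INC : INC (successorARS ℕ-ray)
ℕ-ray-INC = (λ x → x) , λ a b a→b → ℕ.≤-reflexive (sym (ℤ.+-injective (offset-one (+ a) (+ b) a→b)))
  where
  j≡[j-i]+i : ∀ i j → j ≡ (j - i) + i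
  j≡[j-i]+i = solve-∀
  offset-one : ∀ i j → offset i j ≡ just 1ℤ → j ≡ 1ℤ + i
  offset-one i j eq = trans (j≡[j-i]+i i j) (cong (_+ i) (just-injective eq))

module RayAndLine where

  ray-coordinate : ℕ ⊎ ℤ → ℕ
  ray-coordinate (inj₁ x) = x
  ray-coordinate (inj₂ _) = 0

  disp⊎ : ℕ ⊎ ℤ → ℕ ⊎ ℤ → Maybe ℤ
  disp⊎ (inj₁ x) (inj₁ y) = offset (+ x) (+ y)
  disp⊎ (inj₂ x) (inj₂ y) = offset x y
  disp⊎ (inj₁ _) (inj₂ _) = nothing
  disp⊎ (inj₂ _) (inj₁ _) = nothing

  refl⊎ : ∀ x → disp⊎ x x ≡ just 0ℤ
  refl⊎ (inj₁ x) = offset-refl (+ x)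
  refl⊎ (inj₂ x) = offset-refl x

  zero⊎ : ∀ {x y} → disp⊎ x y ≡ just 0ℤ → x ≡ y
  zero⊎ {inj₁ x} {inj₁ y} eq = cong inj₁ (ℤ.+-injective (offset-zero (+ x) (+ y) eq))
  zero⊎ {inj₂ x} {inj₂ y} eq = cong inj₂ (offset-zero x y eq)

  trans⊎ : ∀ {x y z d e} → disp⊎ x y ≡ just d → disp⊎ y z ≡ just e → disp⊎ x z ≡ just (d + e)
  trans⊎ {inj₁ x} {inj₁ y} {inj₁ z} = offset-trans (+ x) (+ y) (+ z)
  trans⊎ {inj₂ x} {inj₂ y} {inj₂ z} = offset-trans x y z
  trans⊎ {inj₁ _} {inj₁ _} {inj₂ _} _ ()
  trans⊎ {inj₂ _} {inj₂ _} {inj₁ _} _ ()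

  sym⊎ : ∀ {x y d} → disp⊎ x y ≡ just d → disp⊎ y x ≡ just (- d)
  sym⊎ {inj₁ x} {inj₁ y} = offset-sym (+ x) (+ y)
  sym⊎ {inj₂ x} {inj₂ y} = offset-sym x y

  origin-minimal⊎ : ∀ {x d} → disp⊎ (inj₁ 0) x ≡ just d → 0ℤ ≤ℤ d
  origin-minimal⊎ {inj₁ _} refl = +≤+ z≤n

  translate⊎ : ∀ x e → (∃ λ y → disp⊎ x y ≡ just e)
                       ⊎ (∃ λ m → disp⊎ (inj₁ 0) x ≡ just m × m + e <ℤ 0ℤ)
  translate⊎ (inj₁ x) e = map₁ (λ (y , x→y) → inj₁ y , x→y) (ℕ-translate x e)
  translate⊎ (inj₂ x) e = inj₁ (inj₂ (x + e) , offset-+ x e)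

  beyond⊎ : ∀ {s} t x → ray-coordinate x ≤ s → ∀ {d} → disp⊎ x (inj₁ (s +ℕ t)) ≡ just d → t ≤ ∣ d ∣
  beyond⊎ t (inj₁ x) x≤s = offset-beyond t x≤s

ℕ⊎ℤ : DisplacementSpace
ℕ⊎ℤ = record
  { Point          = ℕ ⊎ ℤ
  ; origin         = inj₁ 0
  ; disp           = disp⊎
  ; disp-refl      = refl⊎
  ; disp-zero      = zero⊎
  ; disp-trans     = trans⊎
  ; disp-sym       = sym⊎
  ; origin-minimal = origin-minimal⊎
  ; translate      = translate⊎
  ; far-point      = λ P t → inj₁ (upperBound (ray-coordinate ∘ P) +ℕ t) ,
                             λ i → beyond⊎ t (P i) (≤-upperBound (ray-coordinate ∘ P) i)
  }
  where open RayAndLine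

ℕ⊎ℤ-¬INC : ¬ INC (successorARS ℕ⊎ℤ)
ℕ⊎ℤ-¬INC = ¬INC-descending (successorARS ℕ⊎ℤ) (λ m → inj₂ (- + m)) (λ m → cong just (step (+ m)))
  where
  step : ∀ i → (- i) - (- (1ℤ + i)) ≡ 1ℤ
  step = solve-∀

theorem3p18 : ¬ GenFO INC × ¬ GenFO (λ 𝒜 → ¬ INC 𝒜)
theorem3p18 =
  (λ INC-FO → ℕ⊎ℤ-¬INC (GenFO-preserved INC-FO (⊨-transfer ℕ-ray ℕ⊎ℤ) ℕ-ray-INC)) ,
  (λ ¬INC-FO → GenFO-preserved ¬INC-FO (⊨-transfer ℕ⊎ℤ ℕ-ray) ℕ⊎ℤ-¬INC ℕ-ray-INC)
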